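{- Let $G$ be a simple matroid on the ground set $\{0,1,\ldots,n\}$, and for $i\in\{0,\ldots,n\}$ let $d_iG$ denote the pointed matroid with underlying matroid $G$ and base point $i$. Then for any $i,j\in\{0,\ldots,n\}$ we have $\mathcal{A}_d(d_iG)=\mathcal{A}_d(d_jG)$ as subalgebras of $\mathcal{A}(G)$.
   Context: For a simple matroid $G$ on a finite ground set $E$, let $\mathcal{E}=\Lambda(e_i : i\in E)$ be the graded exterior algebra over $\mathbb{C}$ with generators $e_i$ of degree one. For an ordered tuple $S=(i_1,\ldots,i_p)$ write $e_S=e_{i_1}\wedge\cdots\wedge e_{i_p}$, and define $\partial:\mathcal{E}^p\to\mathcal{E}^{p-1}$ by $\partial(e_{i_1}\wedge\cdots\wedge e_{i_p})=\sum_{k=1}^p(-1)^{k-1}e_{i_1}\wedge\cdots\wedge\widehat{e_{i_k}}\wedge\cdots\wedge e_{i_p}$. Let $\mathcal{I}$ be the ideal generated by $\{\partial e_S : S \text{ dependent in } G\}$, and let $\mathcal{A}(G)=\mathcal{E}/\mathcal{I}$ be the Orlik-Solomon algebra, with $a_k$ the image of $e_k$. For the pointed matroid $d_iG$ (base point $i$), its Orlik-Solomon algebra $\mathcal{A}_d(d_iG)$ is the subalgebra of $\mathcal{A}(G)$ generated by $\{a_k-a_i : k\in\{0,\ldots,n\},\ k\neq i\}$. -}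

module Defs where

open import Level using (Level; _⊔_; suc)
open import Data.Nat using (ℕ; _<_; _≤_)
open import Data.Fin using (Fin)
open import Data.Fin.Subset using (Subset; _∈_; _∉_; _⊆_; ⁅_⁆; _∪_; ∣_∣)
  renaming (⊥ to ∅)
open import Data.List using (List; []; _∷_; foldr)
open import Data.List.Relation.Unary.Unique.Propositional using (Unique)
open import Data.Product using (Σ; _×_; ∃-syntax)
open import Relation.Nullary using (¬_)
open import Relation.Binary.PropositionalEquality using (_≡_; _≢_)
open import Algebra.Bundles using (CommutativeRing)

record Matroid (m : ℕ) : Set₁ where
  field
    Indep     : Subset m → Set
    indep-∅   : Indep ∅
    indep-⊆   : ∀ {I J} → J ⊆ I → Indep I → Indep J
    indep-aug : ∀ {I J} → Indep I → Indep J → ∣ I ∣ < ∣ J ∣ →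
                ∃[ x ] (x ∈ J × x ∉ I × Indep (⁅ x ⁆ ∪ I))

IsSimple : ∀ {m} → Matroid m → Set
IsSimple M = ∀ I → ∣ I ∣ ≤ 2 → Matroid.Indep M I

toSet : ∀ {m} → List (Fin m) → Subset m
toSet = foldr (λ i s → ⁅ i ⁆ ∪ s) ∅

Dependent : ∀ {m} → Matroid m → List (Fin m) → Set
Dependent M S = ¬ (Unique S × Matroid.Indep M (toSet S))

-- Orlik–Solomon algebra over a commutative ring K of coefficients,
-- presented as the free associative K-algebra on e_0,…,e_{m-1} modulo the
-- congruence generated by the exterior-algebra relations and the
-- Orlik–Solomon relations ∂ e_S = 0 (S dependent).

module OS {c ℓ} (K : CommutativeRing c ℓ) where
  open CommutativeRing K using (_≈_; _+_; _*_; -_; 0#; 1#) renaming (Carrier to Scalar)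

  infixl 6 _⊕_
  infixl 7 _⊗_

  data Term (m : ℕ) : Set c where
    gen   : Fin m → Term m
    const : Scalar → Term m
    _⊕_   : Term m → Term m → Term m
    _⊗_   : Term m → Term m → Term m

  wedge : ∀ {m} → List (Fin m) → Term m
  wedge = foldr (λ i t → gen i ⊗ t) (const 1#)

  -- ∂ e_S ;  ∂(e_i ∧ e_S) = e_S − e_i ∧ ∂ e_S  (equivalent to the
  -- alternating-sum formula)
  ∂ : ∀ {m} → List (Fin m) → Term m
  ∂ []      = const 0#
  ∂ (i ∷ S) = wedge S ⊕ const (- 1#) ⊗ (gen i ⊗ ∂ S)

  data _≈𝒜_ {m : ℕ} (G : Matroid m) : Term m → Term m → Set (c ⊔ ℓ) where
    refl′  : ∀ {x} → _≈𝒜_ G x x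
    sym′   : ∀ {x y} → _≈𝒜_ G x y → _≈𝒜_ G y x
    trans′ : ∀ {x y z} → _≈𝒜_ G x y → _≈𝒜_ G y z → _≈𝒜_ G x z
    ⊕-cong : ∀ {x x′ y y′} → _≈𝒜_ G x x′ → _≈𝒜_ G y y′ → _≈𝒜_ G (x ⊕ y) (x′ ⊕ y′)
    ⊗-cong : ∀ {x x′ y y′} → _≈𝒜_ G x x′ → _≈𝒜_ G y y′ → _≈𝒜_ G (x ⊗ y) (x′ ⊗ y′)
    const-≈ : ∀ {a b} → a ≈ b → _≈𝒜_ G (const a) (const b)
    const-+ : ∀ a b → _≈𝒜_ G (const (a + b)) (const a ⊕ const b)
    const-* : ∀ a b → _≈𝒜_ G (const (a * b)) (const a ⊗ const b)
    const-central : ∀ a x → _≈𝒜_ G (const a ⊗ x) (x ⊗ const a)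
    ⊕-assoc : ∀ x y z → _≈𝒜_ G ((x ⊕ y) ⊕ z) (x ⊕ (y ⊕ z))
    ⊕-comm  : ∀ x y → _≈𝒜_ G (x ⊕ y) (y ⊕ x)
    ⊕-idʳ   : ∀ x → _≈𝒜_ G (x ⊕ const 0#) x
    ⊕-invʳ  : ∀ x → _≈𝒜_ G (x ⊕ const (- 1#) ⊗ x) (const 0#)
    ⊗-assoc : ∀ x y z → _≈𝒜_ G ((x ⊗ y) ⊗ z) (x ⊗ (y ⊗ z))
    ⊗-idˡ   : ∀ x → _≈𝒜_ G (const 1# ⊗ x) x
    ⊗-idʳ   : ∀ x → _≈𝒜_ G (x ⊗ const 1#) x
    distribˡ : ∀ x y z → _≈𝒜_ G (x ⊗ (y ⊕ z)) (x ⊗ y ⊕ x ⊗ z)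
    distribʳ : ∀ x y z → _≈𝒜_ G ((y ⊕ z) ⊗ x) (y ⊗ x ⊕ z ⊗ x)
    ext-sq   : ∀ i → _≈𝒜_ G (gen i ⊗ gen i) (const 0#)
    ext-anti : ∀ i j → _≈𝒜_ G (gen i ⊗ gen j ⊕ gen j ⊗ gen i) (const 0#)
    os-rel : ∀ S → Dependent G S → _≈𝒜_ G (∂ S) (const 0#)

  data Generated {m : ℕ} (P : Term m → Set c) : Term m → Set c where
    base   : ∀ {t} → P t → Generated P t
    const′ : ∀ a → Generated P (const a)
    _⊕′_   : ∀ {s t} → Generated P s → Generated P t → Generated P (s ⊕ t)
    _⊗′_   : ∀ {s t} → Generated P s → Generated P t → Generated P (s ⊗ t)

  diff : ∀ {m} → Fin m → Fin m → Term m
  diff k i = gen k ⊕ const (- 1#) ⊗ gen i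

  PointedGens : ∀ {m} → Fin m → Term m → Set c
  PointedGens {m} i t = Σ (Fin m) (λ k → k ≢ i × t ≡ diff k i)

  -- membership of the class [t] ∈ 𝒜(G) in the subalgebra 𝒜_d(d_i G)
  -- (t is in 𝒜_d(d_i G) as a subalgebra of 𝒜(G))
  InAd : ∀ {m} (G : Matroid m) → Fin m → Term m → Set (c ⊔ ℓ)
  InAd {m} G i t = Σ (Term m) (λ s → Generated (PointedGens i) s × _≈𝒜_ G t s)

module Submission where

open import Defs
open import Data.Nat using (ℕ; suc)
open import Data.Fin using (Fin; _≟_)
open import Data.Product using (_×_; _,_; Σ)
open import Algebra.Bundles using (CommutativeRing)
open import Relation.Binary.Bundles using (Setoid)
open import Relation.Nullary using (yes; no)
open import Relation.Binary.PropositionalEquality using (refl)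
import Algebra.Properties.Ring as RingProperties
import Relation.Binary.Reasoning.Setoid as SetoidReasoning

-- Since a_k − a_i = (a_k − a_j) − (a_i − a_j), every generator of 𝒜_d(d_i G)
-- lies in 𝒜_d(d_j G), hence so does the subalgebra it generates.

module Rebase {c ℓ} (K : CommutativeRing c ℓ) {m : ℕ} (G : Matroid m) where
  open OS K
  open CommutativeRing K using (_*_; -_; 1#; ring)
    renaming (_≈_ to _≈K_; trans to transK)

  infix 4 _≈_
  _≈_ : Term m → Term m → Set _
  _≈_ = _≈𝒜_ G

  𝒜-setoid : Setoid c _
  𝒜-setoid = record
    { Carrier       = Term m
    ; _≈_           = _≈_
    ; isEquivalence = record { refl = refl′ ; sym = sym′ ; trans = trans′ }
    }

  open SetoidReasoning 𝒜-setoid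

  infix 8 ⊖_
  ⊖_ : Term m → Term m
  ⊖ x = const (- 1#) ⊗ x

  -1*-1≈1 : (- 1#) * (- 1#) ≈K 1#
  -1*-1≈1 = transK (RingProperties.-1*x≈-x ring (- 1#)) (RingProperties.-‿involutive ring 1#)

  ⊖-involutive : ∀ x → ⊖ ⊖ x ≈ x
  ⊖-involutive x = begin
    const (- 1#) ⊗ (const (- 1#) ⊗ x)   ≈⟨ sym′ (⊗-assoc _ _ _) ⟩
    (const (- 1#) ⊗ const (- 1#)) ⊗ x   ≈⟨ ⊗-cong (sym′ (const-* _ _)) refl′ ⟩
    const ((- 1#) * (- 1#)) ⊗ x         ≈⟨ ⊗-cong (const-≈ -1*-1≈1) refl′ ⟩
    const 1# ⊗ x                        ≈⟨ ⊗-idˡ x ⟩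
    x                                   ∎

  ⊖-sub : ∀ x y → ⊖ (x ⊕ ⊖ y) ≈ y ⊕ ⊖ x
  ⊖-sub x y = begin
    ⊖ (x ⊕ ⊖ y)   ≈⟨ distribˡ _ _ _ ⟩
    ⊖ x ⊕ ⊖ ⊖ y   ≈⟨ ⊕-cong refl′ (⊖-involutive y) ⟩
    ⊖ x ⊕ y       ≈⟨ ⊕-comm _ _ ⟩
    y ⊕ ⊖ x       ∎

  sub-sub-cancel : ∀ x y z → (x ⊕ ⊖ y) ⊕ ⊖ (z ⊕ ⊖ y) ≈ x ⊕ ⊖ z
  sub-sub-cancel x y z = begin
    (x ⊕ ⊖ y) ⊕ ⊖ (z ⊕ ⊖ y)   ≈⟨ ⊕-cong refl′ (⊖-sub z y) ⟩
    (x ⊕ ⊖ y) ⊕ (y ⊕ ⊖ z)     ≈⟨ ⊕-assoc _ _ _ ⟩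
    x ⊕ (⊖ y ⊕ (y ⊕ ⊖ z))     ≈⟨ ⊕-cong refl′ (sym′ (⊕-assoc _ _ _)) ⟩
    x ⊕ ((⊖ y ⊕ y) ⊕ ⊖ z)     ≈⟨ ⊕-cong refl′ (⊕-cong (trans′ (⊕-comm _ _) (⊕-invʳ y)) refl′) ⟩
    x ⊕ (const _ ⊕ ⊖ z)       ≈⟨ ⊕-cong refl′ (trans′ (⊕-comm _ _) (⊕-idʳ _)) ⟩
    x ⊕ ⊖ z                   ∎

  Generated≈ : (Term m → Set c) → Term m → Set _
  Generated≈ Q t = Σ (Term m) (λ s → Generated Q s × t ≈ s)

  Generated≈-resp : ∀ {Q t t′} → t ≈ t′ → Generated≈ Q t′ → Generated≈ Q t
  Generated≈-resp t≈t′ (s , gs , t′≈s) = s , gs , trans′ t≈t′ t′≈s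

  Generated≈-trans : ∀ {P Q s} → (∀ {t} → P t → Generated≈ Q t) →
                     Generated P s → Generated≈ Q s
  Generated≈-trans P⊆Q (base p) = P⊆Q p
  Generated≈-trans P⊆Q (const′ a) = _ , const′ a , refl′
  Generated≈-trans P⊆Q (g ⊕′ h) with Generated≈-trans P⊆Q g | Generated≈-trans P⊆Q h
  ... | _ , g′ , g≈ | _ , h′ , h≈ = _ , g′ ⊕′ h′ , ⊕-cong g≈ h≈
  Generated≈-trans P⊆Q (g ⊗′ h) with Generated≈-trans P⊆Q g | Generated≈-trans P⊆Q h
  ... | _ , g′ , g≈ | _ , h′ , h≈ = _ , g′ ⊗′ h′ , ⊗-cong g≈ h≈

  pointedGens-rebase : ∀ i j {t} → PointedGens i t → Generated≈ (PointedGens j) t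
  pointedGens-rebase i j (k , k≢i , refl) with i ≟ j | k ≟ j
  ... | yes refl | _ = _ , base (k , k≢i , refl) , refl′
  ... | no i≢j | yes refl =
    _ , const′ (- 1#) ⊗′ base (i , i≢j , refl) , sym′ (⊖-sub (gen i) (gen j))
  ... | no i≢j | no k≢j =
    _ , base (k , k≢j , refl) ⊕′ (const′ (- 1#) ⊗′ base (i , i≢j , refl)) ,
    sym′ (sub-sub-cancel (gen k) (gen j) (gen i))

  inAd-rebase : ∀ i j t → InAd G i t → InAd G j t
  inAd-rebase i j t (s , gs , t≈s) =
    Generated≈-resp t≈s (Generated≈-trans (pointedGens-rebase i j) gs)

theorem3p4 : ∀ {c ℓ} (K : CommutativeRing c ℓ) (n : ℕ) (G : Matroid (suc n)) →
    IsSimple G → (i j : Fin (suc n)) →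
    ((t : OS.Term K (suc n)) → OS.InAd K G i t → OS.InAd K G j t) ×
    ((t : OS.Term K (suc n)) → OS.InAd K G j t → OS.InAd K G i t)
theorem3p4 K n G _ i j = Rebase.inAd-rebase K G i j , Rebase.inAd-rebase K G j i
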